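{- Fix $m\ge1$ and let $S(n,m)$ be the set of all words of length $2n$ over a complementary alphabet with $m$ complementary pairs (so $|S(n,m)|=(2m)^{2n}$). Then \[\lim_{n\to\infty}\frac{|\mathcal{P}(n,m)|}{|S(n,m)|}=0.\]
   Context: A complementary alphabet with $m$ complementary pairs is a set of $2m$ letters in which every letter $B$ has a unique complement $\overline{B}\neq B$ with $\overline{\overline{B}}=B$. A plane tree is a rooted tree with linearly ordered children at each vertex. For a plane tree with $n$ edges, the $2n$ half-edges are labeled $1,\dots,2n$ by starting on the left side of the leftmost root edge and walking counterclockwise; each edge is $e(i,j)$, $i<j$, with $i,j$ the labels of its sides. For $P=p_1\cdots p_{2n}$, a plane tree with $n$ edges is $P$-valid if $p_i,p_j$ are complements for every edge $e(i,j)$. $\mathcal{P}(n,m)$ denotes the set of words $P$ of length $2n$ over the alphabet for which at least one $P$-valid plane tree exists. -}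

module Defs where

open import Data.Nat using (ℕ; zero; suc; _+_)
open import Data.Bool using (Bool; true; false; not)
open import Data.Fin using (Fin)
open import Data.Product using (_×_; _,_; Σ; ∃)
open import Data.List using (List; []; _∷_; _++_)
open import Data.List.Relation.Unary.All using (All)
open import Data.Vec using (Vec; []; _∷_)
open import Data.Maybe using (Maybe; just; nothing)
open import Relation.Binary.PropositionalEquality using (_≡_)

-- Complementary alphabet with m complementary pairs: letters (a , b) with
-- a : Fin m naming the pair and b : Bool choosing which member; the
-- complement flips b.  (Every complementary alphabet with m pairs is
-- isomorphic to this one.)
Letter : ℕ → Set
Letter m = Fin m × Bool

complement : ∀ {m} → Letter m → Letter m
complement (a , b) = (a , not b)

Word : ℕ → ℕ → Set
Word m k = Vec (Letter m) k

data PlaneTree : Set where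
  node : List PlaneTree → PlaneTree

mutual
  edges : PlaneTree → ℕ
  edges (node cs) = edgesF cs

  edgesF : List PlaneTree → ℕ
  edgesF [] = 0
  edgesF (c ∷ cs) = suc (edges c + edgesF cs)

-- Half-edge labelling by the counterclockwise walk starting on the left
-- side of the leftmost root edge.  Given the next free label s, the walk
-- around the children list cs returns the list of edges e(i,j) (as pairs
-- (i , j) of side labels) and the next free label afterwards.
-- For a child c: the left side of its edge gets label s, the walk around c
-- uses labels from s+1 up to t-1, and the right side gets label t.
mutual
  walk : ℕ → PlaneTree → List (ℕ × ℕ) × ℕ
  walk s (node cs) = walkF s cs

  walkF : ℕ → List PlaneTree → List (ℕ × ℕ) × ℕ
  walkF s [] = ([] , s)
  walkF s (c ∷ cs) with walk (suc s) c
  ... | (es , t) with walkF (suc t) cs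
  ...   | (es' , u) = ((s , t) ∷ es ++ es' , u)

edgeList : PlaneTree → List (ℕ × ℕ)
edgeList t with walk 1 t
... | (es , _) = es

-- p_i for 1-based index i (nothing if out of range)
letterAt : ∀ {A : Set} {k} → Vec A k → ℕ → Maybe A
letterAt [] _ = nothing
letterAt (x ∷ xs) zero = nothing
letterAt (x ∷ xs) (suc zero) = just x
letterAt (x ∷ xs) (suc (suc i)) = letterAt xs (suc i)

ComplAt : ∀ {m k} → Word m k → ℕ × ℕ → Set
ComplAt {m} P (i , j) =
  Σ (Letter m) λ x → letterAt P i ≡ just x × letterAt P j ≡ just (complement x)

Valid : ∀ {m n} → Word m (n + n) → PlaneTree → Set
Valid {n = n} P t = edges t ≡ n × All (ComplAt P) (edgeList t)

InP : (n m : ℕ) → Word m (n + n) → Set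
InP n m P = ∃ λ t → Valid {m} {n} P t

module Submission where

open import Defs
open import Data.Nat using (ℕ; _+_; _*_; _^_; _≤_; _<_)
open import Data.List using (List; length)
open import Data.List.Relation.Unary.All using (All)
open import Data.List.Relation.Unary.Unique.Propositional using (Unique)
open import Data.Product using (∃)

import Algebra.Properties.CommutativeSemigroup as CommutativeSemigroupProperties
open import Data.Bool using (Bool; true; false)
open import Data.Empty using (⊥-elim)
open import Data.List using ([]; _∷_; _++_; map; allFin; cartesianProductWith)
open import Data.List.Membership.Propositional using (_∈_; _─_)
open import Data.List.Membership.Propositional.Properties
  using (∈-map⁺; ∈-allFin; ∈-++⁺ˡ; ∈-++⁺ʳ; ∈-cartesianProductWith⁺)
open import Data.List.Properties using (length-++; length-map; length-tabulate; length-removeAt′; map-++)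
open import Data.List.Relation.Binary.Subset.Propositional using (_⊆_)
import Data.List.Relation.Unary.All as All
open import Data.List.Relation.Unary.AllPairs using (_∷_)
open import Data.List.Relation.Unary.Any using (here; there; index)
open import Data.Maybe using (maybe′)
open import Data.Nat using (zero; suc; _∸_; z≤n; s≤s; z<s)
open import Data.Nat.Combinatorics using (_C_; nC1≡n; nCk≡nC[n∸k]; nCk+nC[k+1]≡[n+1]C[k+1])
open import Data.Nat.ListAction using (sum)
open import Data.Nat.ListAction.Properties using (sum-++)
open import Data.Nat.Properties
open import Data.Nat.Tactic.RingSolver using (solve; solve-∀)
open import Data.Product using (_×_; _,_)
import Data.Vec as Vec
open import Relation.Binary.PropositionalEquality

open CommutativeSemigroupProperties *-commutativeSemigroup using (xy∙z≈y∙xz; x∙yz≈y∙xz)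

-- In a P-valid tree every edge e(i,j) joins complementary letters, and the sides of the n edges
-- are exactly the labels 1, …, 2n; hence a word of 𝒫(n,m) has exactly n letters of weight 1
-- (the members of the pairs flagged true), and there are only m^(2n) C(2n,n) such words.
-- Induction along C(2n+2,n+1) = 2(2n+1)/(n+1) C(2n,n) gives (3n+1) C(2n,n)² ≤ 16ⁿ, so the
-- proportion of such words among all (2m)^(2n) words is at most 1/√(3n+1), below 1/k once n ≥ k².

^-distribʳ-* : ∀ m n k → (m * n) ^ k ≡ m ^ k * n ^ k
^-distribʳ-* m n zero = refl
^-distribʳ-* m n (suc k) = begin
  m * n * (m * n) ^ k       ≡⟨ cong (m * n *_) (^-distribʳ-* m n k) ⟩
  m * n * (m ^ k * n ^ k)   ≡⟨ [m*n]*[o*p]≡[m*o]*[n*p] m n (m ^ k) (n ^ k) ⟩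
  m * m ^ k * (n * n ^ k)   ∎
  where open ≡-Reasoning

[2m]^[2n]≡m^[n+n]*4^n : ∀ m n → (2 * m) ^ (2 * n) ≡ m ^ (n + n) * 4 ^ n
[2m]^[2n]≡m^[n+n]*4^n m n = begin
  (2 * m) ^ (2 * n)          ≡⟨ ^-distribʳ-* 2 m (2 * n) ⟩
  2 ^ (2 * n) * m ^ (2 * n)
    ≡⟨ cong₂ _*_ (sym (^-*-assoc 2 2 n)) (cong (λ e → m ^ (n + e)) (*-identityˡ n)) ⟩
  4 ^ n * m ^ (n + n)        ≡⟨ *-comm (4 ^ n) (m ^ (n + n)) ⟩
  m ^ (n + n) * 4 ^ n        ∎
  where open ≡-Reasoning

[k+1]*[n+1]C[k+1]≡[n+1]*nCk : ∀ n k → suc k * (suc n C suc k) ≡ suc n * (n C k)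
[k+1]*[n+1]C[k+1]≡[n+1]*nCk zero zero = refl
[k+1]*[n+1]C[k+1]≡[n+1]*nCk zero (suc k) = *-zeroʳ (suc (suc k))
[k+1]*[n+1]C[k+1]≡[n+1]*nCk (suc n) zero = begin
  1 * (suc (suc n) C 1)   ≡⟨ *-identityˡ _ ⟩
  suc (suc n) C 1         ≡⟨ nC1≡n (suc (suc n)) ⟩
  suc (suc n)             ≡⟨ *-identityʳ (suc (suc n)) ⟨
  suc (suc n) * 1         ∎
  where open ≡-Reasoning
[k+1]*[n+1]C[k+1]≡[n+1]*nCk (suc n) (suc k) = begin
  suc (suc k) * (suc (suc n) C suc (suc k))
    ≡⟨ cong (suc (suc k) *_) (nCk+nC[k+1]≡[n+1]C[k+1] (suc n) (suc k)) ⟨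
  suc (suc k) * (suc n C suc k + suc n C suc (suc k))
    ≡⟨ *-distribˡ-+ (suc (suc k)) (suc n C suc k) _ ⟩
  suc (suc k) * (suc n C suc k) + suc (suc k) * (suc n C suc (suc k))
    ≡⟨ cong₂ (λ x y → suc n C suc k + x + y)
         ([k+1]*[n+1]C[k+1]≡[n+1]*nCk n k) ([k+1]*[n+1]C[k+1]≡[n+1]*nCk n (suc k)) ⟩
  suc n C suc k + suc n * (n C k) + suc n * (n C suc k)
    ≡⟨ +-assoc (suc n C suc k) _ _ ⟩
  suc n C suc k + (suc n * (n C k) + suc n * (n C suc k))
    ≡⟨ cong (suc n C suc k +_) (*-distribˡ-+ (suc n) (n C k) (n C suc k)) ⟨
  suc n C suc k + suc n * (n C k + n C suc k)
    ≡⟨ cong (λ x → suc n C suc k + suc n * x) (nCk+nC[k+1]≡[n+1]C[k+1] n k) ⟩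
  suc (suc n) * (suc n C suc k)
    ∎
  where open ≡-Reasoning

[2n+1]C[n+1]≡[2n+1]Cn : ∀ n → suc (n + n) C suc n ≡ suc (n + n) C n
[2n+1]C[n+1]≡[2n+1]Cn n = begin
  suc (n + n) C suc n               ≡⟨ nCk≡nC[n∸k] (s≤s (m≤n+m n n)) ⟩
  suc (n + n) C (n + n ∸ n)         ≡⟨ cong (suc (n + n) C_) (m+n∸n≡m n n) ⟩
  suc (n + n) C n                   ∎
  where open ≡-Reasoning

[n+1]*[2n+2]C[n+1]≡2[2n+1]*[2n]Cn : ∀ n →
  suc n * ((suc n + suc n) C suc n) ≡ 2 * suc (n + n) * ((n + n) C n)
[n+1]*[2n+2]C[n+1]≡2[2n+1]*[2n]Cn n = begin
  suc n * ((suc n + suc n) C suc n)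
    ≡⟨ cong (λ j → suc n * (suc j C suc n)) (+-suc n n) ⟩
  suc n * (suc (suc (n + n)) C suc n)
    ≡⟨ [k+1]*[n+1]C[k+1]≡[n+1]*nCk (suc (n + n)) n ⟩
  suc (suc (n + n)) * (suc (n + n) C n)
    ≡⟨ cong (suc (suc (n + n)) *_) ([2n+1]C[n+1]≡[2n+1]Cn n) ⟨
  suc (suc (n + n)) * (suc (n + n) C suc n)
    ≡⟨ [2n+2]*y≡2*[[n+1]*y] (suc (n + n) C suc n) ⟩
  2 * (suc n * (suc (n + n) C suc n))
    ≡⟨ cong (2 *_) ([k+1]*[n+1]C[k+1]≡[n+1]*nCk (n + n) n) ⟩
  2 * (suc (n + n) * ((n + n) C n))
    ≡⟨ *-assoc 2 (suc (n + n)) _ ⟨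
  2 * suc (n + n) * ((n + n) C n)
    ∎
  where
  open ≡-Reasoning
  [2n+2]*y≡2*[[n+1]*y] : ∀ y → suc (suc (n + n)) * y ≡ 2 * (suc n * y)
  [2n+2]*y≡2*[[n+1]*y] y = solve (n ∷ y ∷ [])

[2n+1]²[3n+4]≤4[n+1]²[3n+1] : ∀ n →
  suc (n + n) * suc (n + n) * (3 * n + 4) ≤ 4 * (suc n * suc n) * (3 * n + 1)
[2n+1]²[3n+4]≤4[n+1]²[3n+1] n = begin
  suc (n + n) * suc (n + n) * (3 * n + 4)     ≤⟨ m≤m+n _ n ⟩
  suc (n + n) * suc (n + n) * (3 * n + 4) + n ≡⟨ solve (n ∷ []) ⟩
  4 * (suc n * suc n) * (3 * n + 1)           ∎
  where open ≤-Reasoning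

[3n+1]x²≤16^n-step : ∀ n x y → suc n * y ≡ 2 * suc (n + n) * x →
  (3 * n + 1) * (x * x) ≤ 16 ^ n → (3 * suc n + 1) * (y * y) ≤ 16 ^ suc n
[3n+1]x²≤16^n-step n x y rec bound = *-cancelˡ-≤ (suc n * suc n) (begin
  suc n * suc n * ((3 * suc n + 1) * (y * y))
    ≡⟨ solve (n ∷ y ∷ []) ⟩
  (3 * n + 4) * ((suc n * y) * (suc n * y))
    ≡⟨ cong (λ z → (3 * n + 4) * (z * z)) rec ⟩
  (3 * n + 4) * ((2 * suc (n + n) * x) * (2 * suc (n + n) * x))
    ≡⟨ solve (n ∷ x ∷ []) ⟩
  4 * (suc (n + n) * suc (n + n) * (3 * n + 4)) * (x * x)
    ≤⟨ *-monoˡ-≤ (x * x) (*-monoʳ-≤ 4 ([2n+1]²[3n+4]≤4[n+1]²[3n+1] n)) ⟩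
  4 * (4 * (suc n * suc n) * (3 * n + 1)) * (x * x)
    ≡⟨ solve (n ∷ x ∷ []) ⟩
  16 * (suc n * suc n) * ((3 * n + 1) * (x * x))
    ≤⟨ *-monoʳ-≤ (16 * (suc n * suc n)) bound ⟩
  16 * (suc n * suc n) * 16 ^ n
    ≡⟨ xy∙z≈y∙xz 16 (suc n * suc n) (16 ^ n) ⟩
  suc n * suc n * 16 ^ suc n
    ∎)
  where open ≤-Reasoning

[3n+1]*[2n]Cn²≤16^n : ∀ n → (3 * n + 1) * (((n + n) C n) * ((n + n) C n)) ≤ 16 ^ n
[3n+1]*[2n]Cn²≤16^n zero = ≤-refl
[3n+1]*[2n]Cn²≤16^n (suc n) =
  [3n+1]x²≤16^n-step n _ _ ([n+1]*[2n+2]C[n+1]≡2[2n+1]*[2n]Cn n) ([3n+1]*[2n]Cn²≤16^n n)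

k*c<4^n : ∀ k {n} c → k * k ≤ n → (3 * n + 1) * (c * c) ≤ 16 ^ n → k * c < 4 ^ n
k*c<4^n k {n} zero _ _ = subst (_< 4 ^ n) (sym (*-zeroʳ k)) (m^n>0 4 n)
k*c<4^n k {n} c@(suc _) k²≤n bound =
  ≰⇒> λ 4^n≤kc → <⇒≱ [kc]²<[4^n]² (*-mono-≤ 4^n≤kc 4^n≤kc)
  where
  open ≤-Reasoning
  [kc]²<[4^n]² : k * c * (k * c) < 4 ^ n * 4 ^ n
  [kc]²<[4^n]² = begin-strict
    k * c * (k * c)        ≡⟨ [m*n]*[o*p]≡[m*o]*[n*p] k c k c ⟩
    k * k * (c * c)        ≤⟨ *-monoˡ-≤ (c * c) k²≤n ⟩
    n * (c * c)            <⟨ *-monoˡ-< (c * c) (≤-<-trans (m≤n*m n 3) (m<m+n (3 * n) z<s)) ⟩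
    (3 * n + 1) * (c * c)  ≤⟨ bound ⟩
    16 ^ n                 ≡⟨ ^-distribʳ-* 4 4 n ⟩
    4 ^ n * 4 ^ n          ∎

module _ {A : Set} where

  ∈-─⁺ : ∀ {x y : A} {xs} (x∈xs : x ∈ xs) → y ∈ xs → x ≢ y → y ∈ xs ─ x∈xs
  ∈-─⁺ (here refl)  (here refl)  x≢y = ⊥-elim (x≢y refl)
  ∈-─⁺ (here _)     (there y∈xs) _   = y∈xs
  ∈-─⁺ (there _)    (here y≡z)   _   = here y≡z
  ∈-─⁺ (there x∈xs) (there y∈xs) x≢y = there (∈-─⁺ x∈xs y∈xs x≢y)

  Unique-⊆⇒length≤ : ∀ {xs ys : List A} → Unique xs → xs ⊆ ys → length xs ≤ length ys
  Unique-⊆⇒length≤ {[]}     _               _  = z≤n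
  Unique-⊆⇒length≤ {x ∷ xs} {ys} (x∉xs ∷ unique) xs⊆ys = begin
    suc (length xs)          ≤⟨ s≤s (Unique-⊆⇒length≤ unique xs⊆ys─x) ⟩
    suc (length (ys ─ x∈ys)) ≡⟨ length-removeAt′ ys (index x∈ys) ⟨
    length ys                ∎
    where
    open ≤-Reasoning
    x∈ys : x ∈ ys
    x∈ys = xs⊆ys (here refl)
    xs⊆ys─x : xs ⊆ ys ─ x∈ys
    xs⊆ys─x y∈xs = ∈-─⁺ x∈ys (xs⊆ys (there y∈xs)) (All.lookup x∉xs y∈xs)

length-cartesianProductWith : ∀ {A B C : Set} (f : A → B → C) xs ys →
  length (cartesianProductWith f xs ys) ≡ length xs * length ys
length-cartesianProductWith f []       ys = refl
length-cartesianProductWith f (x ∷ xs) ys = begin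
  length (map (f x) ys ++ cartesianProductWith f xs ys)
    ≡⟨ length-++ (map (f x) ys) ⟩
  length (map (f x) ys) + length (cartesianProductWith f xs ys)
    ≡⟨ cong₂ _+_ (length-map (f x) ys) (length-cartesianProductWith f xs ys) ⟩
  length ys + length xs * length ys
    ∎
  where open ≡-Reasoning

weight : ∀ {m} → Letter m → ℕ
weight (_ , false) = 0
weight (_ , true)  = 1

wordWeight : ∀ {m k} → Word m k → ℕ
wordWeight P = Vec.sum (Vec.map weight P)

module Enumeration (m : ℕ) where

  open import Data.Vec using ([]; _∷_)

  prefixAll : ∀ {j} → Bool → List (Word m j) → List (Word m (suc j))
  prefixAll b = cartesianProductWith _∷_ (map (_, b) (allFin m))

  length-prefixAll : ∀ {j} b (ws : List (Word m j)) → length (prefixAll b ws) ≡ m * length ws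
  length-prefixAll b ws = begin
    length (prefixAll b ws)
      ≡⟨ length-cartesianProductWith _∷_ (map (_, b) (allFin m)) ws ⟩
    length (map (_, b) (allFin m)) * length ws
      ≡⟨ cong (_* length ws) (length-map (_, b) (allFin m)) ⟩
    length (allFin m) * length ws
      ≡⟨ cong (_* length ws) (length-tabulate {n = m} (λ i → i)) ⟩
    m * length ws
      ∎
    where open ≡-Reasoning

  ∈-prefixAll : ∀ {j} {a b} {w : Word m j} {ws} → w ∈ ws → (a , b) ∷ w ∈ prefixAll b ws
  ∈-prefixAll {a = a} {b} = ∈-cartesianProductWith⁺ _∷_ (∈-map⁺ (_, b) (∈-allFin a))

  wordsOfWeight : (j c : ℕ) → List (Word m j)
  wordsOfWeight zero    zero    = [] ∷ []
  wordsOfWeight zero    (suc c) = []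
  wordsOfWeight (suc j) zero    = prefixAll false (wordsOfWeight j zero)
  wordsOfWeight (suc j) (suc c) =
    prefixAll false (wordsOfWeight j (suc c)) ++ prefixAll true (wordsOfWeight j c)

  length-wordsOfWeight : ∀ j c → length (wordsOfWeight j c) ≡ m ^ j * (j C c)
  length-wordsOfWeight zero    zero    = refl
  length-wordsOfWeight zero    (suc c) = refl
  length-wordsOfWeight (suc j) zero    = begin
    length (prefixAll false (wordsOfWeight j zero))  ≡⟨ length-prefixAll false (wordsOfWeight j zero) ⟩
    m * length (wordsOfWeight j zero)                ≡⟨ cong (m *_) (length-wordsOfWeight j zero) ⟩
    m * (m ^ j * 1)                                  ≡⟨ *-assoc m (m ^ j) 1 ⟨
    m * m ^ j * 1                                    ∎
    where open ≡-Reasoning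
  length-wordsOfWeight (suc j) (suc c) = begin
    length (prefixAll false (wordsOfWeight j (suc c)) ++ prefixAll true (wordsOfWeight j c))
      ≡⟨ length-++ (prefixAll false (wordsOfWeight j (suc c))) ⟩
    length (prefixAll false (wordsOfWeight j (suc c))) + length (prefixAll true (wordsOfWeight j c))
      ≡⟨ cong₂ _+_ (length-prefixAll false (wordsOfWeight j (suc c)))
                   (length-prefixAll true (wordsOfWeight j c)) ⟩
    m * length (wordsOfWeight j (suc c)) + m * length (wordsOfWeight j c)
      ≡⟨ cong₂ (λ x y → m * x + m * y)
               (length-wordsOfWeight j (suc c)) (length-wordsOfWeight j c) ⟩
    m * (m ^ j * (j C suc c)) + m * (m ^ j * (j C c))
      ≡⟨ regroup m (m ^ j) (j C c) (j C suc c) ⟩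
    m * m ^ j * (j C c + j C suc c)
      ≡⟨ cong (m * m ^ j *_) (nCk+nC[k+1]≡[n+1]C[k+1] j c) ⟩
    m * m ^ j * (suc j C suc c)
      ∎
    where
    open ≡-Reasoning
    regroup : ∀ a p x y → a * (p * y) + a * (p * x) ≡ a * p * (x + y)
    regroup = solve-∀

  ∈-wordsOfWeight : ∀ {j} (w : Word m j) → w ∈ wordsOfWeight j (wordWeight w)
  ∈-wordsOfWeight []                = here refl
  ∈-wordsOfWeight ((a , false) ∷ w) = ∈-prefixAll-false (wordWeight w) (∈-wordsOfWeight w)
    where
    ∈-prefixAll-false : ∀ {j} {w : Word m j} c →
      w ∈ wordsOfWeight j c → (a , false) ∷ w ∈ wordsOfWeight (suc j) c
    ∈-prefixAll-false zero    w∈ws = ∈-prefixAll w∈ws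
    ∈-prefixAll-false (suc c) w∈ws = ∈-++⁺ˡ (∈-prefixAll w∈ws)
  ∈-wordsOfWeight ((a , true) ∷ w) = ∈-++⁺ʳ _ (∈-prefixAll (∈-wordsOfWeight w))

module _ (v : ℕ → ℕ) where

  rangeSum : ℕ → ℕ → ℕ
  rangeSum s zero    = 0
  rangeSum s (suc l) = v s + rangeSum (suc s) l

  rangeSum-+ : ∀ s x y → rangeSum s (x + y) ≡ rangeSum s x + rangeSum (s + x) y
  rangeSum-+ s zero    y = cong (λ s′ → rangeSum s′ y) (sym (+-identityʳ s))
  rangeSum-+ s (suc x) y = begin
    v s + rangeSum (suc s) (x + y)
      ≡⟨ cong (v s +_) (rangeSum-+ (suc s) x y) ⟩
    v s + (rangeSum (suc s) x + rangeSum (suc s + x) y)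
      ≡⟨ +-assoc (v s) _ _ ⟨
    v s + rangeSum (suc s) x + rangeSum (suc s + x) y
      ≡⟨ cong (λ s′ → v s + rangeSum (suc s) x + rangeSum s′ y) (+-suc s x) ⟨
    v s + rangeSum (suc s) x + rangeSum (s + suc x) y
      ∎
    where open ≡-Reasoning

  edgeSum : List (ℕ × ℕ) → ℕ
  edgeSum es = sum (map (λ (i , j) → v i + v j) es)

  edgeSum-++ : ∀ es es′ → edgeSum (es ++ es′) ≡ edgeSum es + edgeSum es′
  edgeSum-++ es es′ = trans (cong sum (map-++ _ es es′)) (sum-++ (map _ es) _)

  -- The walk from label s around a subtree with e edges uses the labels s, …, s + 2e − 1,
  -- each as exactly one side of one edge.
  WalkInvariant : ℕ → ℕ → List (ℕ × ℕ) × ℕ → Set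
  WalkInvariant s e (es , next) =
    next ≡ s + (e + e) × length es ≡ e × rangeSum s (e + e) ≡ edgeSum es

  walk-invariant  : ∀ s t  → WalkInvariant s (edges t) (walk s t)
  walkF-invariant : ∀ s cs → WalkInvariant s (edgesF cs) (walkF s cs)
  walk-invariant s (node cs) = walkF-invariant s cs
  walkF-invariant s [] = sym (+-identityʳ s) , refl , refl
  walkF-invariant s (c ∷ cs)
    with walk (suc s) c | walk-invariant (suc s) c
  ... | es , _ | refl , length-es , sum-es
    with walkF (suc (suc s + (edges c + edges c))) cs
       | walkF-invariant (suc (suc s + (edges c + edges c))) cs
  ... | es′ , _ | refl , length-es′ , sum-es′ =
      next-label s a b
    , cong suc (trans (length-++ es) (cong₂ _+_ length-es length-es′))
    , (begin
        rangeSum s (suc (a + b) + suc (a + b))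
          ≡⟨ cong (rangeSum s) (labels-split a b) ⟩
        v s + rangeSum (suc s) ((a + a) + suc (b + b))
          ≡⟨ cong (v s +_) (rangeSum-+ (suc s) (a + a) (suc (b + b))) ⟩
        v s + (rangeSum (suc s) (a + a) + (v t + rangeSum (suc t) (b + b)))
          ≡⟨ cong₂ (λ x y → v s + (x + (v t + y))) sum-es sum-es′ ⟩
        v s + (edgeSum es + (v t + edgeSum es′))
          ≡⟨ regroup (v s) (v t) (edgeSum es) (edgeSum es′) ⟩
        (v s + v t) + (edgeSum es + edgeSum es′)
          ≡⟨ cong ((v s + v t) +_) (edgeSum-++ es es′) ⟨
        (v s + v t) + edgeSum (es ++ es′)
          ∎)
    where
    open ≡-Reasoning
    a b t : ℕ
    a = edges c
    b = edgesF cs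
    t = suc s + (a + a)
    next-label : ∀ s x y → suc (suc s + (x + x)) + (y + y) ≡ s + (suc (x + y) + suc (x + y))
    next-label s x y = solve (s ∷ x ∷ y ∷ [])
    labels-split : ∀ x y → suc (x + y) + suc (x + y) ≡ suc ((x + x) + suc (y + y))
    labels-split x y = solve (x ∷ y ∷ [])
    regroup : ∀ x y z w → x + (z + (y + w)) ≡ (x + y) + (z + w)
    regroup x y z w = solve (x ∷ y ∷ z ∷ w ∷ [])

module _ {m : ℕ} where

  open import Data.Vec using ([]; _∷_)

  weightAt : ∀ {k} → Word m k → ℕ → ℕ
  weightAt P i = maybe′ weight 0 (letterAt P i)

  weight+weight∘complement≡1 : (x : Letter m) → weight x + weight (complement x) ≡ 1
  weight+weight∘complement≡1 (_ , false) = refl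
  weight+weight∘complement≡1 (_ , true)  = refl

  edgeSum-complementary : ∀ {k} (P : Word m k) {es} →
    All (ComplAt P) es → edgeSum (weightAt P) es ≡ length es
  edgeSum-complementary P All.[] = refl
  edgeSum-complementary P {(i , j) ∷ _} ((x , pᵢ≡x , pⱼ≡x̄) All.∷ compl) =
    cong₂ _+_ edge≡1 (edgeSum-complementary P compl)
    where
    edge≡1 : weightAt P i + weightAt P j ≡ 1
    edge≡1 rewrite pᵢ≡x | pⱼ≡x̄ = weight+weight∘complement≡1 x

  rangeSum-weightAt-∷ : ∀ {k} (x : Letter m) (P : Word m k) s l →
    rangeSum (weightAt (x ∷ P)) (suc (suc s)) l ≡ rangeSum (weightAt P) (suc s) l
  rangeSum-weightAt-∷ x P s zero    = refl
  rangeSum-weightAt-∷ x P s (suc l) = cong (weightAt P (suc s) +_) (rangeSum-weightAt-∷ x P (suc s) l)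

  rangeSum-weightAt : ∀ {k} (P : Word m k) → rangeSum (weightAt P) 1 k ≡ wordWeight P
  rangeSum-weightAt []      = refl
  rangeSum-weightAt {suc k} (x ∷ P) =
    cong (weight x +_) (trans (rangeSum-weightAt-∷ x P 0 k) (rangeSum-weightAt P))

wordWeight-valid : ∀ {n m} (P : Word m (n + n)) → InP n m P → wordWeight P ≡ n
wordWeight-valid {n} P (t , edges≡n , compl) with walk 1 t | walk-invariant (weightAt P) 1 t
... | es , _ | _ , length-es , sum-es = begin
  wordWeight P                                 ≡⟨ rangeSum-weightAt P ⟨
  rangeSum (weightAt P) 1 (n + n)              ≡⟨ cong (λ e → rangeSum (weightAt P) 1 (e + e)) edges≡n ⟨
  rangeSum (weightAt P) 1 (edges t + edges t)  ≡⟨ sum-es ⟩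
  edgeSum (weightAt P) es                      ≡⟨ edgeSum-complementary P compl ⟩
  length es                                    ≡⟨ trans length-es edges≡n ⟩
  n                                            ∎
  where open ≡-Reasoning

length-validWords≤ : ∀ {n m} (L : List (Word m (n + n))) → Unique L → All (InP n m) L →
  length L ≤ m ^ (n + n) * ((n + n) C n)
length-validWords≤ {n} {m} L unique valid = begin
  length L                          ≤⟨ Unique-⊆⇒length≤ unique L⊆wordsOfWeight ⟩
  length (wordsOfWeight (n + n) n)  ≡⟨ length-wordsOfWeight (n + n) n ⟩
  m ^ (n + n) * ((n + n) C n)       ∎
  where
  open ≤-Reasoning
  open Enumeration m
  L⊆wordsOfWeight : L ⊆ wordsOfWeight (n + n) n
  L⊆wordsOfWeight {P} P∈L =
    subst (λ c → P ∈ wordsOfWeight (n + n) c)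
          (wordWeight-valid P (All.lookup valid P∈L)) (∈-wordsOfWeight P)

mainTheorem16 : (m : ℕ) → 1 ≤ m → (k : ℕ) → 1 ≤ k →
    ∃ λ N → (n : ℕ) → N ≤ n →
      (L : List (Word m (n + n))) → Unique L → All (InP n m) L →
      k * length L < (2 * m) ^ (2 * n)
mainTheorem16 m@(suc _) _ k _ = k * k , λ n k²≤n L unique valid →
  let instance _ = m^n≢0 m (n + n) in
  begin-strict
    k * length L
      ≤⟨ *-monoʳ-≤ k (length-validWords≤ L unique valid) ⟩
    k * (m ^ (n + n) * ((n + n) C n))
      ≡⟨ x∙yz≈y∙xz k (m ^ (n + n)) _ ⟩
    m ^ (n + n) * (k * ((n + n) C n))
      <⟨ *-monoʳ-< (m ^ (n + n)) (k*c<4^n k ((n + n) C n) k²≤n ([3n+1]*[2n]Cn²≤16^n n)) ⟩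
    m ^ (n + n) * 4 ^ n
      ≡⟨ [2m]^[2n]≡m^[n+n]*4^n m n ⟨
    (2 * m) ^ (2 * n)
      ∎
  where open ≤-Reasoning
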